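{- Let $P$ be a nonempty pattern. If $U\subseteq P$ satisfies $\varphi(P\setminus U)=\varphi(P)$, then $|U|\le e(P)$.
   Context: A pattern is a finite subset $P\subset\mathbb{Z}^2$. Let $T=\{(0,1),(1,1),(1,0)\}$ and $T_n=\{(a,b)\in\{0,\ldots,n-1\}^2 : a+b\geq n-1\}$. The filling $\varphi(P)$ is obtained by repeatedly adding a point $w$ whenever there is $v$ with $|P\cap(v+T)|=2$ (current set) and $w\in v+T$, until stable ($\varphi(\varnothing)=\varnothing$). Let $N(x)=\{x\pm(1,0),x\pm(0,1),x\pm(1,-1)\}$ and $N(A)=\bigcup_{x\in A}N(x)$. The filling decomposes uniquely (up to order) as $\varphi(P)=\bigcup_{i=1}^r(v_i+T_{k_i})$ with $N(v_i+T_{k_i})\cap(v_j+T_{k_j})=\varnothing$ for $i\ne j$; the excess is $e(P)=|P|-\sum_i k_i$. Sets $U$ as in the claim are called excess sets of $P$. -}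

module Defs where

open import Data.Nat using (ℕ; suc)
open import Data.Integer as ℤ using (ℤ; +_; -[1+_]; _+_; _-_; _≤_; _<_)
open import Data.Product using (_×_; _,_; Σ; ∃; ∃-syntax)
open import Data.Sum using (_⊎_)
open import Data.Fin as Fin using (Fin)
import Data.Nat
open import Data.List using (List; length)
open import Data.List.Membership.Propositional using (_∈_)
open import Data.List.Relation.Unary.Unique.Propositional using (Unique)
open import Relation.Nullary using (¬_)
open import Relation.Binary.PropositionalEquality using (_≡_; _≢_)
open import Function.Bundles using (_⇔_)

Point : Set
Point = ℤ × ℤ

_⊕_ : Point → Point → Point
(a , b) ⊕ (c , d) = (a + c , b + d)

_⊖_ : Point → Point → Point
(a , b) ⊖ (c , d) = (a - c , b - d)

-- A pattern: a finite subset of ℤ², given as a duplicate-free list.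
record Pattern : Set where
  constructor mkPattern
  field
    elems  : List Point
    unique : Unique elems
open Pattern public

∣_∣ₚ : Pattern → ℕ
∣ P ∣ₚ = length (elems P)

_∈ₚ_ : Point → Pattern → Set
x ∈ₚ P = x ∈ elems P

InT : Point → Point → Set
InT v x = (x ≡ v ⊕ (+ 0 , + 1)) ⊎ (x ≡ v ⊕ (+ 1 , + 1)) ⊎ (x ≡ v ⊕ (+ 1 , + 0))

-- This is exactly the stable
-- result of the iterative filling procedure.
data Fill (S : Point → Set) : Point → Set where
  base : ∀ {x} → S x → Fill S x
  step : ∀ v p q w → InT v p → InT v q → p ≢ q →
         Fill S p → Fill S q → InT v w → Fill S w

φ : Pattern → Point → Set
φ P = Fill (λ x → x ∈ₚ P)

InTri : Point → ℕ → Point → Set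
InTri (v₁ , v₂) k (x₁ , x₂) = let a = x₁ - v₁ ; b = x₂ - v₂ in
  (+ 0 ≤ a) × (a < + k) × (+ 0 ≤ b) × (b < + k) × ((+ k) - + 1 ≤ a + b)

Nbr : Point → Point → Set
Nbr x y = (y ≡ x ⊕ (+ 1 , + 0)) ⊎ (y ≡ x ⊕ (-[1+ 0 ] , + 0))
        ⊎ (y ≡ x ⊕ (+ 0 , + 1)) ⊎ (y ≡ x ⊕ (+ 0 , -[1+ 0 ]))
        ⊎ (y ≡ x ⊕ (+ 1 , -[1+ 0 ])) ⊎ (y ≡ x ⊕ (-[1+ 0 ] , + 1))

sumFin : ∀ {r} → (Fin r → ℕ) → ℕ
sumFin {0}     f = 0
sumFin {suc r} f = f Fin.zero Data.Nat.+ sumFin (λ i → f (Fin.suc i))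

record Decomposition (P : Pattern) : Set where
  field
    r        : ℕ
    v        : Fin r → Point
    k        : Fin r → ℕ
    k-pos    : ∀ i → 1 Data.Nat.≤ k i
    distinct : ∀ i j → i ≢ j → (v i , k i) ≢ (v j , k j)
    union    : ∀ x → φ P x ⇔ (∃[ i ] InTri (v i) (k i) x)
    separated : ∀ i j → i ≢ j →
                ¬ (∃[ x ] ∃[ y ] (InTri (v i) (k i) x × Nbr x y × InTri (v j) (k j) y))
open Decomposition public

-- The excess e(P) = |P| - Σ k_i, computed from a decomposition
-- (the decomposition is unique up to order, so this is well defined).
excess : (P : Pattern) → Decomposition P → ℤ
excess P D = (+ ∣ P ∣ₚ) - (+ sumFin (k D))

-- Since φ(P ∖ U) = φ(P), the decomposition of φ(P) is also one of φ(P ∖ U), so it suffices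
-- to show e(Q) ≥ 0, i.e. Σ kᵢ ≤ |Q|, for every pattern Q.  Call a point p of a finite set B
-- full if p + (1,0) and p + (1,-1) lie in B, and let Φ(B) be the number of non-full points
-- of B.  A filling step that adds the missing corner w of some v + T never increases Φ:
-- either w = v + (0,1) is itself full, or v + (0,1) was non-full before and is full after.
-- Filling Q until all right-column points vᵢ + (kᵢ - 1, b) of the triangles are present
-- therefore gives a set B with Φ(B) ≤ Φ(Q) ≤ |Q|, and these Σ kᵢ points are non-full in B
-- because their east neighbours lie outside φ(Q), by the separation of the triangles.
module Submission where

open import Defs
open import Algebra.Properties.AbelianGroup using (xyx⁻¹≈y)
open import Data.Empty using (⊥-elim)
open import Data.Fin as Fin using (Fin; toℕ)
import Data.Fin.Properties as FinP
open import Data.Integer as ℤ using (+_; -[1+_]; _≤_)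
import Data.Integer.Properties as ℤP
open import Data.List using (List; []; _∷_; _++_; length; lookup; filter; tabulate)
import Data.List.Properties as ListP
open import Data.List.Membership.Propositional using (_∈_; _∉_)
open import Data.List.Membership.Propositional.Properties
  using (∈-lookup; ∈-filter⁺; ∈-filter⁻; ∈-++⁻; ∈-tabulate⁻)
open import Data.List.Relation.Binary.Disjoint.Propositional using (Disjoint)
open import Data.List.Relation.Binary.Subset.Propositional using (_⊆_)
open import Data.List.Relation.Unary.All as All using (All)
open import Data.List.Relation.Unary.AllPairs using ([]; _∷_)
open import Data.List.Relation.Unary.Any using (here; there; index)
open import Data.List.Relation.Unary.Any.Properties using (lookup-index)
open import Data.List.Relation.Unary.Unique.Propositional using (Unique)
import Data.List.Relation.Unary.Unique.Propositional.Properties as UniqueP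
open import Data.Nat as ℕ using (ℕ; zero; suc; z≤n; s≤s)
import Data.Nat.Properties as ℕP
open import Data.Product using (Σ; _×_; _,_; ∃-syntax; proj₁; proj₂)
open import Data.Product.Properties using (≡-dec)
open import Data.Sum using (inj₁; inj₂)
open import Function using (_∘_)
open import Function.Bundles using (_⇔_; mk⇔; Equivalence)
import Function.Properties.Equivalence as ⇔
open import Relation.Binary.Definitions using (DecidableEquality)
open import Relation.Binary.PropositionalEquality
open import Relation.Nullary using (¬_; yes; no; ¬?; _×-dec_; map′)
open import Relation.Unary using (Pred; Decidable)

module _ {a} {A : Set a} where

  lookup-injective : ∀ {xs : List A} → Unique xs → ∀ {i j} → lookup xs i ≡ lookup xs j → i ≡ j
  lookup-injective (_ ∷ _)  {Fin.zero}  {Fin.zero}  _  = refl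
  lookup-injective (x∉ ∷ _) {Fin.zero}  {Fin.suc j} eq = ⊥-elim (All.lookup x∉ (∈-lookup j) eq)
  lookup-injective (x∉ ∷ _) {Fin.suc i} {Fin.zero}  eq = ⊥-elim (All.lookup x∉ (∈-lookup i) (sym eq))
  lookup-injective (_ ∷ u)  {Fin.suc i} {Fin.suc j} eq = cong Fin.suc (lookup-injective u eq)

  unique⊆⇒length≤ : ∀ {xs ys : List A} → Unique xs → xs ⊆ ys → length xs ℕ.≤ length ys
  unique⊆⇒length≤ {xs} {ys} xs-unique xs⊆ys = FinP.injective⇒≤ position-injective
    where
    position : Fin (length xs) → Fin (length ys)
    position i = index (xs⊆ys (∈-lookup i))

    position-injective : ∀ {i j} → position i ≡ position j → i ≡ j
    position-injective {i} {j} eq = lookup-injective xs-unique (begin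
      lookup xs i             ≡⟨ lookup-index (xs⊆ys (∈-lookup i)) ⟩
      lookup ys (position i)  ≡⟨ cong (lookup ys) eq ⟩
      lookup ys (position j)  ≡⟨ lookup-index (xs⊆ys (∈-lookup j)) ⟨
      lookup xs j             ∎)
      where open ≡-Reasoning

  length-filter-∷ : ∀ {p} {P : Pred A p} (P? : Decidable P) x xs →
                    length (filter P? (x ∷ xs)) ℕ.≤ suc (length (filter P? xs))
  length-filter-∷ P? x xs with P? x
  ... | yes _ = ℕP.≤-refl
  ... | no _  = ℕP.n≤1+n _

  module _ {p q} {P : Pred A p} {Q : Pred A q}
           (P? : Decidable P) (Q? : Decidable Q) (P⇒Q : ∀ {x} → P x → Q x) where

    length-filter-mono : ∀ xs → length (filter P? xs) ℕ.≤ length (filter Q? xs)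
    length-filter-mono [] = z≤n
    length-filter-mono (x ∷ xs) with P? x | Q? x
    ... | yes _  | yes _  = s≤s (length-filter-mono xs)
    ... | yes px | no ¬qx = ⊥-elim (¬qx (P⇒Q px))
    ... | no _   | yes _  = ℕP.m≤n⇒m≤1+n (length-filter-mono xs)
    ... | no _   | no _   = length-filter-mono xs

    length-filter-strict : ∀ {y xs} → y ∈ xs → Q y → ¬ P y →
                           length (filter P? xs) ℕ.< length (filter Q? xs)
    length-filter-strict {xs = x ∷ xs} (here refl) qx ¬px with P? x | Q? x
    ... | yes px | _      = ⊥-elim (¬px px)
    ... | no _   | yes _  = s≤s (length-filter-mono xs)
    ... | no _   | no ¬qx = ⊥-elim (¬qx qx)
    length-filter-strict {xs = x ∷ xs} (there y∈xs) qy ¬py with P? x | Q? x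
    ... | yes _  | yes _  = s≤s (length-filter-strict y∈xs qy ¬py)
    ... | yes px | no ¬qx = ⊥-elim (¬qx (P⇒Q px))
    ... | no _   | yes _  = ℕP.m≤n⇒m≤1+n (length-filter-strict y∈xs qy ¬py)
    ... | no _   | no _   = length-filter-strict y∈xs qy ¬py

m+n≤o⇒+m≤+o-+n : ∀ {m n o} → m ℕ.+ n ℕ.≤ o → + m ≤ + o ℤ.- + n
m+n≤o⇒+m≤+o-+n {m} {n} {o} m+n≤o =
  subst (+ m ≤_) (sym (trans (ℤP.[+m]-[+n]≡m⊖n o n) (ℤP.⊖-≥ (ℕP.m+n≤o⇒n≤o m m+n≤o))))
        (ℤ.+≤+ (ℕP.m+n≤o⇒m≤o∸n m m+n≤o))

[i+j]-i≡j : ∀ i j → i ℤ.+ j ℤ.- i ≡ j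
[i+j]-i≡j = xyx⁻¹≈y ℤP.+-0-abelianGroup

_≟ₚ_ : DecidableEquality Point
_≟ₚ_ = ≡-dec ℤ._≟_ ℤ._≟_

open import Data.List.Membership.DecPropositional _≟ₚ_ using (_∈?_)

⊕-assoc : ∀ u v w → (u ⊕ v) ⊕ w ≡ u ⊕ (v ⊕ w)
⊕-assoc (u₁ , u₂) (v₁ , v₂) (w₁ , w₂) = cong₂ _,_ (ℤP.+-assoc u₁ v₁ w₁) (ℤP.+-assoc u₂ v₂ w₂)

⊕-identityʳ : ∀ v → v ⊕ (+ 0 , + 0) ≡ v
⊕-identityʳ (v₁ , v₂) = cong₂ _,_ (ℤP.+-identityʳ v₁) (ℤP.+-identityʳ v₂)

east southeast : Point
east      = + 1 , + 0
southeast = + 1 , -[1+ 0 ]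

nw ne se : Point → Point
nw v = v ⊕ (+ 0 , + 1)
ne v = v ⊕ (+ 1 , + 1)
se v = v ⊕ (+ 1 , + 0)

nw⊕east≡ne : ∀ v → nw v ⊕ east ≡ ne v
nw⊕east≡ne v = ⊕-assoc v _ _

nw⊕southeast≡se : ∀ v → nw v ⊕ southeast ≡ se v
nw⊕southeast≡se v = ⊕-assoc v _ _

Fill-map : ∀ {S T : Point → Set} → (∀ {x} → S x → T x) → ∀ {x} → Fill S x → Fill T x
Fill-map f (base s)                          = base (f s)
Fill-map f (step v p q w ip iq p≢q fp fq iw) =
  step v p q w ip iq p≢q (Fill-map f fp) (Fill-map f fq) iw

data Completion (B : List Point) (v : Point) : Point → Set where
  at-nw : ne v ∈ B → se v ∈ B → Completion B v (nw v)
  at-ne : nw v ∈ B → se v ∈ B → Completion B v (ne v)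
  at-se : nw v ∈ B → ne v ∈ B → Completion B v (se v)

completion : ∀ {B v p q w} → InT v p → InT v q → p ≢ q → p ∈ B → q ∈ B →
             InT v w → w ∉ B → Completion B v w
completion (inj₂ (inj₁ refl)) (inj₂ (inj₂ refl)) _ p∈ q∈ (inj₁ refl)        _ = at-nw p∈ q∈
completion (inj₂ (inj₂ refl)) (inj₂ (inj₁ refl)) _ p∈ q∈ (inj₁ refl)        _ = at-nw q∈ p∈
completion (inj₁ refl)        (inj₂ (inj₂ refl)) _ p∈ q∈ (inj₂ (inj₁ refl)) _ = at-ne p∈ q∈
completion (inj₂ (inj₂ refl)) (inj₁ refl)        _ p∈ q∈ (inj₂ (inj₁ refl)) _ = at-ne q∈ p∈
completion (inj₁ refl)        (inj₂ (inj₁ refl)) _ p∈ q∈ (inj₂ (inj₂ refl)) _ = at-se p∈ q∈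
completion (inj₂ (inj₁ refl)) (inj₁ refl)        _ p∈ q∈ (inj₂ (inj₂ refl)) _ = at-se q∈ p∈
completion (inj₁ refl)        (inj₁ refl)        p≢q _ _ _ _ = ⊥-elim (p≢q refl)
completion (inj₂ (inj₁ refl)) (inj₂ (inj₁ refl)) p≢q _ _ _ _ = ⊥-elim (p≢q refl)
completion (inj₂ (inj₂ refl)) (inj₂ (inj₂ refl)) p≢q _ _ _ _ = ⊥-elim (p≢q refl)
completion (inj₁ refl)        _ _ p∈ _ (inj₁ refl)        w∉ = ⊥-elim (w∉ p∈)
completion (inj₂ (inj₁ refl)) _ _ p∈ _ (inj₂ (inj₁ refl)) w∉ = ⊥-elim (w∉ p∈)
completion (inj₂ (inj₂ refl)) _ _ p∈ _ (inj₂ (inj₂ refl)) w∉ = ⊥-elim (w∉ p∈)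
completion _ (inj₁ refl)        _ _ q∈ (inj₁ refl)        w∉ = ⊥-elim (w∉ q∈)
completion _ (inj₂ (inj₁ refl)) _ _ q∈ (inj₂ (inj₁ refl)) w∉ = ⊥-elim (w∉ q∈)
completion _ (inj₂ (inj₂ refl)) _ _ q∈ (inj₂ (inj₂ refl)) w∉ = ⊥-elim (w∉ q∈)

record Full (B : List Point) (p : Point) : Set where
  constructor full
  field
    east∈      : p ⊕ east ∈ B
    southeast∈ : p ⊕ southeast ∈ B

full? : (B : List Point) → Decidable (Full B)
full? B p = map′ (λ (e∈ , s∈) → full e∈ s∈) (λ (full e∈ s∈) → e∈ , s∈)
                 ((p ⊕ east ∈? B) ×-dec (p ⊕ southeast ∈? B))

nonFull? : (B : List Point) → Decidable (λ p → ¬ Full B p)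
nonFull? B = ¬? ∘ full? B

nonFull-∷ : ∀ {w B p} → ¬ Full (w ∷ B) p → ¬ Full B p
nonFull-∷ ¬full (full e∈ s∈) = ¬full (full (there e∈) (there s∈))

nw-full : ∀ {B} v → ne v ∈ B → se v ∈ B → Full B (nw v)
nw-full v ne∈ se∈ =
  full (subst (_∈ _) (sym (nw⊕east≡ne v)) ne∈) (subst (_∈ _) (sym (nw⊕southeast≡se v)) se∈)

Full-nw⇒ne∈ : ∀ {B} v → Full B (nw v) → ne v ∈ B
Full-nw⇒ne∈ v (full east∈ _) = subst (_∈ _) (nw⊕east≡ne v) east∈

Full-nw⇒se∈ : ∀ {B} v → Full B (nw v) → se v ∈ B
Full-nw⇒se∈ v (full _ southeast∈) = subst (_∈ _) (nw⊕southeast≡se v) southeast∈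

Φ : List Point → ℕ
Φ B = length (filter (nonFull? B) B)

Φ≤length : ∀ B → Φ B ℕ.≤ length B
Φ≤length B = ListP.length-filter (nonFull? B) B

Φ-∷-full : ∀ {w B} → Full (w ∷ B) w → Φ (w ∷ B) ℕ.≤ Φ B
Φ-∷-full {w} {B} w-full = begin
  Φ (w ∷ B)
    ≡⟨ cong length (ListP.filter-reject (nonFull? (w ∷ B)) (λ ¬full → ¬full w-full)) ⟩
  length (filter (nonFull? (w ∷ B)) B)
    ≤⟨ length-filter-mono (nonFull? (w ∷ B)) (nonFull? B) nonFull-∷ B ⟩
  Φ B ∎
  where open ℕP.≤-Reasoning

Φ-∷-completes : ∀ {w B y} → y ∈ B → ¬ Full B y → Full (w ∷ B) y → Φ (w ∷ B) ℕ.≤ Φ B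
Φ-∷-completes {w} {B} y∈ y-nonFull y-full = begin
  Φ (w ∷ B)
    ≤⟨ length-filter-∷ (nonFull? (w ∷ B)) w B ⟩
  suc (length (filter (nonFull? (w ∷ B)) B))
    ≤⟨ length-filter-strict (nonFull? (w ∷ B)) (nonFull? B) nonFull-∷
                            y∈ y-nonFull (λ ¬full → ¬full y-full) ⟩
  Φ B ∎
  where open ℕP.≤-Reasoning

Φ-completion : ∀ {B v w} → Completion B v w → w ∉ B → Φ (w ∷ B) ℕ.≤ Φ B
Φ-completion {v = v} (at-nw ne∈ se∈) _ = Φ-∷-full (nw-full v (there ne∈) (there se∈))
Φ-completion {v = v} (at-ne nw∈ se∈) w∉ =
  Φ-∷-completes nw∈ (w∉ ∘ Full-nw⇒ne∈ v) (nw-full v (here refl) (there se∈))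
Φ-completion {v = v} (at-se nw∈ ne∈) w∉ =
  Φ-∷-completes nw∈ (w∉ ∘ Full-nw⇒se∈ v) (nw-full v (there ne∈) (here refl))

module _ (S : Point → Set) where

  record Enlargement (B : List Point) : Set where
    field
      list  : List Point
      ⊇B    : B ⊆ list
      sound : ∀ {y} → y ∈ list → Fill S y
      Φ-≤   : Φ list ℕ.≤ Φ B

  open Enlargement

  Enlargement-refl : ∀ {B} → (∀ {y} → y ∈ B → Fill S y) → Enlargement B
  Enlargement-refl {B} B-sound = record
    { list = B ; ⊇B = λ y∈ → y∈ ; sound = B-sound ; Φ-≤ = ℕP.≤-refl }

  Enlargement-trans : ∀ {B} (E : Enlargement B) → Enlargement (list E) → Enlargement B
  Enlargement-trans E F = record
    { list = list F ; ⊇B = ⊇B F ∘ ⊇B E ; sound = sound F ; Φ-≤ = ℕP.≤-trans (Φ-≤ F) (Φ-≤ E) }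

  enlarge : ∀ {B x} → (∀ {y} → S y → y ∈ B) → (∀ {y} → y ∈ B → Fill S y) →
            Fill S x → ∃[ E ] x ∈ list {B} E
  enlarge S⊆B B-sound (base s) = Enlargement-refl B-sound , S⊆B s
  enlarge S⊆B B-sound fw@(step v p q w ip iq p≢q fp fq iw)
    with E₁ , p∈ ← enlarge S⊆B B-sound fp
    with E₂ , q∈ ← enlarge (⊇B E₁ ∘ S⊆B) (sound E₁) fq
    with w ∈? list E₂
  ... | yes w∈ = Enlargement-trans E₁ E₂ , w∈
  ... | no w∉  = Enlargement-trans E₁ (Enlargement-trans E₂ add-w) , here refl
    where
    add-w : Enlargement (list E₂)
    add-w = record
      { list  = w ∷ list E₂
      ; ⊇B    = there
      ; sound = λ { (here refl) → fw ; (there y∈) → sound E₂ y∈ }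
      ; Φ-≤   = Φ-completion (completion {v = v} ip iq p≢q (⊇B E₂ p∈) q∈ iw w∉) w∉
      }

  enlarge-all : ∀ {B xs} → (∀ {y} → S y → y ∈ B) → (∀ {y} → y ∈ B → Fill S y) →
                All (Fill S) xs → ∃[ E ] xs ⊆ list {B} E
  enlarge-all S⊆B B-sound All.[] = Enlargement-refl B-sound , λ ()
  enlarge-all S⊆B B-sound (fx All.∷ fxs)
    with E₁ , x∈ ← enlarge S⊆B B-sound fx
    with E₂ , xs⊆ ← enlarge-all (⊇B E₁ ∘ S⊆B) (sound E₁) fxs
    = Enlargement-trans E₁ E₂ , λ { (here refl) → ⊇B E₂ x∈ ; (there y∈) → xs⊆ y∈ }

open Enlargement

offset∈Tri : ∀ {k a b} v → a ℕ.< k → b ℕ.< k → k ℕ.≤ suc (a ℕ.+ b) →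
             InTri v k (v ⊕ (+ a , + b))
offset∈Tri {suc k} {a} {b} (v₁ , v₂) a<k b<k k≤a+b+1
  rewrite [i+j]-i≡j v₁ (+ a) | [i+j]-i≡j v₂ (+ b) =
  ℤ.+≤+ z≤n , ℤ.+<+ a<k , ℤ.+≤+ z≤n , ℤ.+<+ b<k , ℤ.+≤+ (ℕP.≤-pred k≤a+b+1)

offset∉Tri : ∀ {k a b} v → k ℕ.≤ a → ¬ InTri v k (v ⊕ (+ a , + b))
offset∉Tri {k} {a} (v₁ , _) k≤a (_ , a<k , _) =
  ℕP.<⇒≱ (ℤP.drop‿+<+ (subst (ℤ._< + k) ([i+j]-i≡j v₁ (+ a)) a<k)) k≤a

column : Point → ℕ → ℕ → Point
column v k b = v ⊕ (+ (k ℕ.∸ 1) , + b)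

column∈Tri : ∀ {k b} v → 1 ℕ.≤ k → b ℕ.< k → InTri v k (column v k b)
column∈Tri {suc k} {b} v _ b<k = offset∈Tri v ℕP.≤-refl b<k (s≤s (ℕP.m≤m+n k b))

column⊕east∉Tri : ∀ {k b} v → ¬ InTri v k (column v k b ⊕ east)
column⊕east∉Tri {k} v = offset∉Tri v (k≤k∸1+1 k) ∘ subst (InTri v k) (⊕-assoc v _ east)
  where
  k≤k∸1+1 : ∀ k → k ℕ.≤ k ℕ.∸ 1 ℕ.+ 1
  k≤k∸1+1 zero    = z≤n
  k≤k∸1+1 (suc k) = ℕP.≤-reflexive (ℕP.+-comm 1 k)

column-injective : ∀ {k b c} v → column v k b ≡ column v k c → b ≡ c
column-injective {b = b} {c} (_ , v₂) eq = ℤP.+-injective (begin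
  + b                     ≡⟨ [i+j]-i≡j v₂ (+ b) ⟨
  v₂ ℤ.+ + b ℤ.- v₂       ≡⟨ cong (λ p → proj₂ p ℤ.- v₂) eq ⟩
  v₂ ℤ.+ + c ℤ.- v₂       ≡⟨ [i+j]-i≡j v₂ (+ c) ⟩
  + c                     ∎)
  where open ≡-Reasoning

column⊕vertical : ∀ {k b} v d → column v k b ⊕ (+ 0 , d) ≡ v ⊕ (+ (k ℕ.∸ 1) , + b ℤ.+ d)
column⊕vertical {k} {b} v d =
  trans (⊕-assoc v _ (+ 0 , d)) (cong (λ a → v ⊕ (a , + b ℤ.+ d)) (ℤP.+-identityʳ (+ (k ℕ.∸ 1))))

column-neighbour : ∀ {k b} v → 2 ℕ.≤ k → b ℕ.< k → ∃[ y ] InTri v k y × Nbr (column v k b) y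
column-neighbour {suc (suc k)} {zero} v _ _ =
  v ⊕ (+ suc k , + 1) ,
  offset∈Tri v ℕP.≤-refl (s≤s (s≤s z≤n)) (s≤s (s≤s (ℕP.m≤m+n k 1))) ,
  inj₂ (inj₂ (inj₁ (sym (column⊕vertical {suc (suc k)} v (+ 1)))))
column-neighbour {suc (suc k)} {suc b} v _ b+1<k =
  v ⊕ (+ suc k , + b) ,
  offset∈Tri v ℕP.≤-refl (ℕP.<-trans (ℕP.n<1+n b) b+1<k) (s≤s (s≤s (ℕP.m≤m+n k b))) ,
  inj₂ (inj₂ (inj₂ (inj₁ (sym (column⊕vertical {suc (suc k)} v -[1+ 0 ])))))
column-neighbour {1} _ (s≤s ()) _

Separated : Point → ℕ → Point → ℕ → Set
Separated vᵢ kᵢ vⱼ kⱼ = ¬ (∃[ x ] ∃[ y ] (InTri vᵢ kᵢ x × Nbr x y × InTri vⱼ kⱼ y))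

-- A right-column point of a triangle of size ≥ 2 has a neighbour inside that triangle, so it
-- cannot lie in a triangle separated from it; a triangle of size 1 is the single point v.
columns-apart : ∀ {vᵢ kᵢ bᵢ vⱼ kⱼ bⱼ} → 1 ℕ.≤ kᵢ → 1 ℕ.≤ kⱼ → bᵢ ℕ.< kᵢ → bⱼ ℕ.< kⱼ →
                Separated vᵢ kᵢ vⱼ kⱼ → Separated vⱼ kⱼ vᵢ kᵢ → (vᵢ , kᵢ) ≢ (vⱼ , kⱼ) →
                column vᵢ kᵢ bᵢ ≢ column vⱼ kⱼ bⱼ
columns-apart {vᵢ} {suc (suc _)} {_} {vⱼ} {kⱼ} {bⱼ} _ 1≤kⱼ bᵢ<kᵢ bⱼ<kⱼ _ sepⱼᵢ _ eq
  with y , y∈Tᵢ , nbr ← column-neighbour vᵢ (s≤s (s≤s z≤n)) bᵢ<kᵢ =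
  sepⱼᵢ (column vⱼ kⱼ bⱼ , y , column∈Tri vⱼ 1≤kⱼ bⱼ<kⱼ , subst (λ x → Nbr x y) eq nbr , y∈Tᵢ)
columns-apart {vᵢ} {1} {bᵢ} {vⱼ} {suc (suc _)} 1≤kᵢ _ bᵢ<kᵢ bⱼ<kⱼ sepᵢⱼ _ _ eq
  with y , y∈Tⱼ , nbr ← column-neighbour vⱼ (s≤s (s≤s z≤n)) bⱼ<kⱼ =
  sepᵢⱼ (column vᵢ 1 bᵢ , y , column∈Tri vᵢ 1≤kᵢ bᵢ<kᵢ , subst (λ x → Nbr x y) (sym eq) nbr , y∈Tⱼ)
columns-apart {vᵢ} {1} {0} {vⱼ} {1} {0} _ _ _ _ _ _ vᵢkᵢ≢vⱼkⱼ eq =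
  vᵢkᵢ≢vⱼkⱼ (cong (_, 1) (trans (sym (⊕-identityʳ vᵢ)) (trans eq (⊕-identityʳ vⱼ))))
columns-apart {kᵢ = 1} {suc _} _ _ (s≤s ()) _ _ _ _ _
columns-apart {kⱼ = 1} {bⱼ = suc _} _ _ _ (s≤s ()) _ _ _ _

rightColumn : Point → ℕ → List Point
rightColumn v k = tabulate {n = k} (column v k ∘ toℕ)

rightColumns : ∀ {r} → (Fin r → Point) → (Fin r → ℕ) → List Point
rightColumns {zero}  v k = []
rightColumns {suc r} v k =
  rightColumn (v Fin.zero) (k Fin.zero) ++ rightColumns (v ∘ Fin.suc) (k ∘ Fin.suc)

length-rightColumns : ∀ {r} (v : Fin r → Point) k → length (rightColumns v k) ≡ sumFin k
length-rightColumns {zero}  v k = refl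
length-rightColumns {suc r} v k =
  trans (ListP.length-++ (rightColumn (v Fin.zero) (k Fin.zero)))
        (cong₂ ℕ._+_ (ListP.length-tabulate _) (length-rightColumns (v ∘ Fin.suc) (k ∘ Fin.suc)))

∈-rightColumns⁻ : ∀ {r} (v : Fin r → Point) k {x} → x ∈ rightColumns v k →
                  ∃[ i ] Σ (Fin (k i)) λ b → x ≡ column (v i) (k i) (toℕ b)
∈-rightColumns⁻ {suc r} v k x∈ with ∈-++⁻ (rightColumn (v Fin.zero) (k Fin.zero)) x∈
... | inj₁ x∈col =
  let b , eq = ∈-tabulate⁻ {f = column (v Fin.zero) (k Fin.zero) ∘ toℕ} x∈col in Fin.zero , b , eq
... | inj₂ x∈rest =
  let i , b , eq = ∈-rightColumns⁻ (v ∘ Fin.suc) (k ∘ Fin.suc) x∈rest in Fin.suc i , b , eq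

rightColumns-unique : ∀ {r} (v : Fin r → Point) k →
                      (∀ i j (b : Fin (k i)) (c : Fin (k j)) →
                       column (v i) (k i) (toℕ b) ≡ column (v j) (k j) (toℕ c) → i ≡ j) →
                      Unique (rightColumns v k)
rightColumns-unique {zero}  v k _ = []
rightColumns-unique {suc r} v k determines =
  UniqueP.++⁺ (UniqueP.tabulate⁺ (FinP.toℕ-injective ∘ column-injective {k Fin.zero} (v Fin.zero)))
              (rightColumns-unique (v ∘ Fin.suc) (k ∘ Fin.suc)
                 (λ i j b c eq → FinP.suc-injective (determines (Fin.suc i) (Fin.suc j) b c eq)))
              disjoint
  where
  disjoint : Disjoint (rightColumn (v Fin.zero) (k Fin.zero)) (rightColumns (v ∘ Fin.suc) (k ∘ Fin.suc))
  disjoint (x∈col , x∈rest)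
    with b , eq₀ ← ∈-tabulate⁻ {f = column (v Fin.zero) (k Fin.zero) ∘ toℕ} x∈col
    with j , c , eq ← ∈-rightColumns⁻ (v ∘ Fin.suc) (k ∘ Fin.suc) x∈rest
    with () ← determines Fin.zero (Fin.suc j) b c (trans (sym eq₀) eq)

module _ {P : Pattern} (D : Decomposition P) where

  decomposition-rightColumns-unique : Unique (rightColumns (v D) (k D))
  decomposition-rightColumns-unique = rightColumns-unique (v D) (k D) determines
    where
    determines : ∀ i j (b : Fin (k D i)) (c : Fin (k D j)) →
                 column (v D i) (k D i) (toℕ b) ≡ column (v D j) (k D j) (toℕ c) → i ≡ j
    determines i j b c eq with i Fin.≟ j
    ... | yes i≡j = i≡j
    ... | no i≢j  = ⊥-elim (columns-apart (k-pos D i) (k-pos D j) (FinP.toℕ<n b) (FinP.toℕ<n c)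
                              (separated D i j i≢j) (separated D j i (i≢j ∘ sym))
                              (distinct D i j i≢j) eq)

  decomposition-column∈φ : ∀ {x} → x ∈ rightColumns (v D) (k D) → φ P x
  decomposition-column∈φ x∈ with i , b , refl ← ∈-rightColumns⁻ (v D) (k D) x∈ =
    Equivalence.from (union D _) (i , column∈Tri (v D i) (k-pos D i) (FinP.toℕ<n b))

  decomposition-column⊕east∉φ : ∀ {x} → x ∈ rightColumns (v D) (k D) → ¬ φ P (x ⊕ east)
  decomposition-column⊕east∉φ x∈ φx⊕east
    with i , b , refl ← ∈-rightColumns⁻ (v D) (k D) x∈
    with j , x⊕east∈Tⱼ ← Equivalence.to (union D _) φx⊕east
    with i Fin.≟ j
  ... | yes refl = column⊕east∉Tri (v D i) x⊕east∈Tⱼ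
  ... | no i≢j   = separated D i j i≢j
                     (column (v D i) (k D i) (toℕ b) , _ ,
                      column∈Tri (v D i) (k-pos D i) (FinP.toℕ<n b) , inj₁ refl , x⊕east∈Tⱼ)

sumFin-k≤∣P∣ₚ : (P : Pattern) (D : Decomposition P) → sumFin (k D) ℕ.≤ ∣ P ∣ₚ
sumFin-k≤∣P∣ₚ P D = begin
  sumFin (k D)  ≡⟨ length-rightColumns (v D) (k D) ⟨
  length cols   ≤⟨ unique⊆⇒length≤ (decomposition-rightColumns-unique D) cols⊆nonFull ⟩
  Φ (list E)    ≤⟨ Φ-≤ E ⟩
  Φ (elems P)   ≤⟨ Φ≤length (elems P) ⟩
  ∣ P ∣ₚ        ∎
  where
  open ℕP.≤-Reasoning
  cols = rightColumns (v D) (k D)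
  enlarged = enlarge-all (_∈ₚ P) (λ y∈ → y∈) base (All.tabulate (decomposition-column∈φ D))
  E = proj₁ enlarged

  cols⊆nonFull : cols ⊆ filter (nonFull? (list E)) (list E)
  cols⊆nonFull x∈ = ∈-filter⁺ (nonFull? (list E)) (proj₂ enlarged x∈)
                      (λ (full east∈ _) → decomposition-column⊕east∉φ D x∈ (sound E east∈))

infixl 25 _∖_

_∖_ : Pattern → List Point → Pattern
P ∖ U = mkPattern (filter (λ x → ¬? (x ∈? U)) (elems P)) (UniqueP.filter⁺ _ (unique P))

∈ₚ-∖⁻ : ∀ P U {x} → x ∈ₚ P ∖ U → x ∈ₚ P × x ∉ U
∈ₚ-∖⁻ P U = ∈-filter⁻ (λ x → ¬? (x ∈? U))

∈ₚ-∖⁺ : ∀ P U {x} → x ∈ₚ P → x ∉ U → x ∈ₚ P ∖ U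
∈ₚ-∖⁺ P U = ∈-filter⁺ (λ x → ¬? (x ∈? U))

length+∣∖∣≤∣∣ : ∀ P {U} → Unique U → All (_∈ₚ P) U → length U ℕ.+ ∣ P ∖ U ∣ₚ ℕ.≤ ∣ P ∣ₚ
length+∣∖∣≤∣∣ P {U} U-unique U⊆P = begin
  length U ℕ.+ ∣ P ∖ U ∣ₚ      ≡⟨ ListP.length-++ U ⟨
  length (U ++ elems (P ∖ U))  ≤⟨ unique⊆⇒length≤ (UniqueP.++⁺ U-unique (unique (P ∖ U)) disjoint)
                                                   U++P∖U⊆P ⟩
  ∣ P ∣ₚ                       ∎
  where
  open ℕP.≤-Reasoning
  disjoint : Disjoint U (elems (P ∖ U))
  disjoint (x∈U , x∈P∖U) = proj₂ (∈ₚ-∖⁻ P U x∈P∖U) x∈U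

  U++P∖U⊆P : U ++ elems (P ∖ U) ⊆ elems P
  U++P∖U⊆P x∈ with ∈-++⁻ U x∈
  ... | inj₁ x∈U   = All.lookup U⊆P x∈U
  ... | inj₂ x∈P∖U = proj₁ (∈ₚ-∖⁻ P U x∈P∖U)

φ[∖]⇔ : ∀ P U x → φ (P ∖ U) x ⇔ Fill (λ y → y ∈ₚ P × y ∉ U) x
φ[∖]⇔ P U x = mk⇔ (Fill-map (∈ₚ-∖⁻ P U)) (Fill-map (λ (y∈P , y∉U) → ∈ₚ-∖⁺ P U y∈P y∉U))

Decomposition-resp-φ : ∀ {P Q} → (∀ x → φ P x ⇔ φ Q x) → Decomposition P → Decomposition Q
Decomposition-resp-φ φP⇔φQ D = record
  { r         = r D
  ; v         = v D
  ; k         = k D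
  ; k-pos     = k-pos D
  ; distinct  = distinct D
  ; union     = λ x → ⇔.trans (⇔.sym (φP⇔φQ x)) (union D x)
  ; separated = separated D
  }

lemma4 : (P : Pattern) → elems P ≢ [] →
    (U : List Point) → Unique U → All (λ u → u ∈ₚ P) U →
    (∀ x → Fill (λ y → y ∈ₚ P × ¬ (y ∈ U)) x ⇔ φ P x) →
    (D : Decomposition P) →
    + length U ≤ excess P D
lemma4 P _ U U-unique U⊆P φ[P∖U]⇔φP D = m+n≤o⇒+m≤+o-+n (begin
  length U ℕ.+ sumFin (k D)  ≤⟨ ℕP.+-monoʳ-≤ (length U) (sumFin-k≤∣P∣ₚ (P ∖ U) D′) ⟩
  length U ℕ.+ ∣ P ∖ U ∣ₚ    ≤⟨ length+∣∖∣≤∣∣ P U-unique U⊆P ⟩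
  ∣ P ∣ₚ                     ∎)
  where
  open ℕP.≤-Reasoning
  D′ : Decomposition (P ∖ U)
  D′ = Decomposition-resp-φ (λ x → ⇔.trans (⇔.sym (φ[P∖U]⇔φP x)) (⇔.sym (φ[∖]⇔ P U x))) D
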